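{- Consider the multiplication of predicates on $X$ given by $p\cdot q=[\mathrm{id},\kappa_2]\circ(p+\mathrm{id})\circ q=[p,\kappa_2]\circ q$. (i) It yields a monoid structure on $\mathrm{Pred}(X)$ with the truth predicate $1$ as unit element. (ii) In case $\mathrm{Pred}(X)$ is an effect algebra, via the partial sum $\boxplus$, multiplication is a bihomomorphism, making each $\mathrm{Pred}(X)$ an effect monoid. (iii) Multiplication is preserved by substitution functors $f^*$.
   Context: $\mathcal{C}$ has coproducts. A predicate on $X$ is $p\colon X\to X+X$ with $\nabla\circ p=\mathrm{id}$ ($\nabla=[\mathrm{id},\mathrm{id}]$); $\mathrm{Pred}(X)$ is their set, $1=\kappa_1$, $0=\kappa_2$. Partial sum: $p\boxplus q=(\nabla+\mathrm{id})\circ b$ when there is a bound $b\colon X\to(X+X)+X$ with $[\mathrm{id},\kappa_2]\circ b=p$, $[[\kappa_2,\kappa_1],\kappa_2]\circ b=q$. A bihomomorphism preserves $\boxplus$ (and $0$) in each argument separately; an effect monoid is an effect algebra with such a bihomomorphic monoid multiplication with unit 1. Substitution along $f\colon X\to Y$ is defined through the pullback square (D) ($f+f\colon X+X\to Y+Y$ over $f\colon X\to Y$ with verticals $\nabla$): $f^*(q)$ is the unique map with $\nabla\circ f^*(q)=\mathrm{id}$ and $(f+f)\circ f^*(q)=q\circ f$. Here $\boxplus$ denotes the partial sum operation. -}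

module Defs where

open import Level using (Level; _⊔_; suc)
open import Data.Product using (Σ; _×_; _,_; ∃)
open import Relation.Binary.PropositionalEquality using (_≡_)

record CategoryWithCoproducts (o ℓ : Level) : Set (suc (o ⊔ ℓ)) where
  infixr 9 _∘_
  infixr 6 _+_
  field
    Obj : Set o
    Hom : Obj → Obj → Set ℓ
    id  : ∀ {A} → Hom A A
    _∘_ : ∀ {A B C} → Hom B C → Hom A B → Hom A C
    identityˡ : ∀ {A B} {f : Hom A B} → id ∘ f ≡ f
    identityʳ : ∀ {A B} {f : Hom A B} → f ∘ id ≡ f
    assoc : ∀ {A B C D} {f : Hom A B} {g : Hom B C} {h : Hom C D} →
            (h ∘ g) ∘ f ≡ h ∘ (g ∘ f)
    _+_ : Obj → Obj → Obj
    κ₁  : ∀ {A B} → Hom A (A + B)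
    κ₂  : ∀ {A B} → Hom B (A + B)
    [_,_] : ∀ {A B C} → Hom A C → Hom B C → Hom (A + B) C
    inject₁ : ∀ {A B C} {f : Hom A C} {g : Hom B C} → [ f , g ] ∘ κ₁ ≡ f
    inject₂ : ∀ {A B C} {f : Hom A C} {g : Hom B C} → [ f , g ] ∘ κ₂ ≡ g
    unique  : ∀ {A B C} {f : Hom A C} {g : Hom B C} {h : Hom (A + B) C} →
              h ∘ κ₁ ≡ f → h ∘ κ₂ ≡ g → h ≡ [ f , g ]

module _ {o ℓ} (𝒞 : CategoryWithCoproducts o ℓ) where
  open CategoryWithCoproducts 𝒞

  _⊹_ : ∀ {A B C D} → Hom A C → Hom B D → Hom (A + B) (C + D)
  f ⊹ g = [ κ₁ ∘ f , κ₂ ∘ g ]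

  ∇ : ∀ {A} → Hom (A + A) A
  ∇ = [ id , id ]

  IsPred : ∀ {X} → Hom X (X + X) → Set ℓ
  IsPred p = ∇ ∘ p ≡ id

  𝟏 : ∀ {X} → Hom X (X + X)
  𝟏 = κ₁

  𝟎 : ∀ {X} → Hom X (X + X)
  𝟎 = κ₂

  mul : ∀ {X} → Hom X (X + X) → Hom X (X + X) → Hom X (X + X)
  mul p q = [ p , κ₂ ] ∘ q

  -- (the paper's first expression for the product, [id,κ₂] ∘ (p + id) ∘ q)
  mul' : ∀ {X} → Hom X (X + X) → Hom X (X + X) → Hom X (X + X)
  mul' p q = [ id , κ₂ ] ∘ (p ⊹ id) ∘ q

  IsBound : ∀ {X} → Hom X (X + X) → Hom X (X + X) → Hom X ((X + X) + X) → Set ℓ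
  IsBound p q b = ([ id , κ₂ ] ∘ b ≡ p) × ([ [ κ₂ , κ₁ ] , κ₂ ] ∘ b ≡ q)

  -- Sum p q s  :  p ⊞ q is defined and equals s
  -- (i.e. there is a bound b for p, q with s = (∇ + id) ∘ b)
  Sum : ∀ {X} → Hom X (X + X) → Hom X (X + X) → Hom X (X + X) → Set ℓ
  Sum p q s = Σ _ λ b → IsBound p q b × ((∇ ⊹ id) ∘ b ≡ s)

  record IsEffectAlgebra (X : Obj) : Set (o ⊔ ℓ) where
    field
      ⊞-functional : ∀ {p q s s'} → IsPred {X} p → IsPred q →
                     Sum p q s → Sum p q s' → s ≡ s'
      ⊞-comm  : ∀ {p q s} → IsPred {X} p → IsPred q → Sum p q s → Sum q p s
      ⊞-assoc : ∀ {p q r s t} → IsPred {X} p → IsPred q → IsPred r →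
                Sum {X} p q s → Sum s r t →
                Σ _ λ u → Sum q r u × Sum p u t
      ⊞-zero  : ∀ {p} → IsPred {X} p → Sum p 𝟎 p
      orthosupplement : ∀ {p} → IsPred {X} p →
                        Σ _ λ p' → IsPred p' × Sum p p' 𝟏
      orthosupplement-unique : ∀ {p p' p''} → IsPred {X} p → IsPred p' → IsPred p'' →
                               Sum p p' 𝟏 → Sum p p'' 𝟏 → p' ≡ p''
      zero-one : ∀ {p s} → IsPred {X} p → Sum p 𝟏 s → p ≡ 𝟎

  MonoidOnPred : Obj → Set ℓ
  MonoidOnPred X =
    (∀ {p q : Hom X (X + X)} → IsPred p → IsPred q → IsPred (mul p q)) ×
    (∀ {p q r : Hom X (X + X)} → IsPred p → IsPred q → IsPred r →
       mul (mul p q) r ≡ mul p (mul q r)) ×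
    (∀ {p : Hom X (X + X)} → IsPred p → mul 𝟏 p ≡ p) ×
    (∀ {p : Hom X (X + X)} → IsPred p → mul p 𝟏 ≡ p)

  MulBihomomorphism : Obj → Set ℓ
  MulBihomomorphism X =
    (∀ {r p q s : Hom X (X + X)} → IsPred r → IsPred p → IsPred q →
       Sum p q s → Sum (mul r p) (mul r q) (mul r s)) ×
    (∀ {r : Hom X (X + X)} → IsPred r → mul r 𝟎 ≡ 𝟎) ×
    (∀ {r p q s : Hom X (X + X)} → IsPred r → IsPred p → IsPred q →
       Sum p q s → Sum (mul p r) (mul q r) (mul s r)) ×
    (∀ {r : Hom X (X + X)} → IsPred r → mul 𝟎 r ≡ 𝟎)

  record DIsPullback {X Y : Obj} (f : Hom X Y) : Set (o ⊔ ℓ) where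
    field
      mediate : ∀ {Z} (u : Hom Z (Y + Y)) (v : Hom Z X) →
                ∇ ∘ u ≡ f ∘ v → Hom Z (X + X)
      mediate-top : ∀ {Z} {u : Hom Z (Y + Y)} {v : Hom Z X} (eq : ∇ ∘ u ≡ f ∘ v) →
                    (f ⊹ f) ∘ mediate u v eq ≡ u
      mediate-left : ∀ {Z} {u : Hom Z (Y + Y)} {v : Hom Z X} (eq : ∇ ∘ u ≡ f ∘ v) →
                     ∇ ∘ mediate u v eq ≡ v
      mediate-unique : ∀ {Z} {u : Hom Z (Y + Y)} {v : Hom Z X} (eq : ∇ ∘ u ≡ f ∘ v)
                       (w : Hom Z (X + X)) →
                       (f ⊹ f) ∘ w ≡ u → ∇ ∘ w ≡ v → w ≡ mediate u v eq

  private
    ≡-trans : ∀ {a} {A : Set a} {x y z : A} → x ≡ y → y ≡ z → x ≡ z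
    ≡-trans _≡_.refl q = q
    ≡-sym : ∀ {a} {A : Set a} {x y : A} → x ≡ y → y ≡ x
    ≡-sym _≡_.refl = _≡_.refl
    ≡-cong : ∀ {a b} {A : Set a} {B : Set b} (g : A → B) {x y : A} → x ≡ y → g x ≡ g y
    ≡-cong g _≡_.refl = _≡_.refl

  substSquare : ∀ {X Y} (f : Hom X Y) (q : Hom Y (Y + Y)) → IsPred q →
                ∇ ∘ (q ∘ f) ≡ f ∘ id
  substSquare f q pq =
    ≡-trans (≡-sym assoc)
      (≡-trans (≡-cong (_∘ f) pq) (≡-trans identityˡ (≡-sym identityʳ)))

  subst* : ∀ {X Y} {f : Hom X Y} → DIsPullback f →
           (q : Hom Y (Y + Y)) → IsPred q → Hom X (X + X)
  subst* {f = f} pb q pq = DIsPullback.mediate pb (q ∘ f) id (substSquare f q pq)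

module Submission where

-- For a fixed object E, the functor (−) + E is a monad (the
-- "exception" monad), and its Kleisli extension of p : A → B + E is
-- ext p = [ p , κ₂ ] : A + E → B + E.  The product of predicates is then
-- Kleisli composition, p · q = ext p ∘ q, so:
--   * the two formulas for p · q agree because ext p = [ id , κ₂ ] ∘ (p + id);
--   * (i) associativity and the unit laws are the monad laws of ext;
--   * (ii) the three read-out maps of a bound, [ id , κ₂ ], [ [ κ₂ , κ₁ ] , κ₂ ]
--     and ∇ + id, are themselves Kleisli extensions ext [ g₁ , g₂ ] with
--     g₁, g₂ ∈ {κ₁, κ₂}.  Hence a bound b for p, q yields the bound ext b ∘ r
--     for p · r, q · r (by associativity), and the bound "scale r ∘ b" for
--     r · p, r · q, using that κ₁ and κ₂ commute with every predicate r.

open import Defs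
open import Level using (Level)
open import Data.Product using (_×_; _,_)
open import Relation.Binary.PropositionalEquality
  using (_≡_; refl; sym; trans; cong; cong₂; module ≡-Reasoning)

module Lemmas {o ℓ : Level} (𝒞 : CategoryWithCoproducts o ℓ) where
  open CategoryWithCoproducts 𝒞
  open ≡-Reasoning

  infixr 6 _⊕_
  _⊕_ : ∀ {A B C D} → Hom A C → Hom B D → Hom (A + B) (C + D)
  f ⊕ g = _⊹_ 𝒞 f g

  infixl 7 _·_
  _·_ : ∀ {X} → Hom X (X + X) → Hom X (X + X) → Hom X (X + X)
  p · q = mul 𝒞 p q

  ∘-copair : ∀ {A B C D} (h : Hom C D) {a : Hom A C} {b : Hom B C} →
             h ∘ [ a , b ] ≡ [ h ∘ a , h ∘ b ]
  ∘-copair h = unique (trans assoc (cong (h ∘_) inject₁))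
                      (trans assoc (cong (h ∘_) inject₂))

  copair-η : ∀ {A B} → [ κ₁ {A} {B} , κ₂ ] ≡ id
  copair-η = sym (unique identityˡ identityˡ)

  copair-κ₁∘ : ∀ {A B C D} {f : Hom A C} {g : Hom B C} (x : Hom D A) →
               [ f , g ] ∘ (κ₁ ∘ x) ≡ f ∘ x
  copair-κ₁∘ x = trans (sym assoc) (cong (_∘ x) inject₁)

  copair-κ₂∘ : ∀ {A B C D} {f : Hom A C} {g : Hom B C} (x : Hom D B) →
               [ f , g ] ∘ (κ₂ ∘ x) ≡ g ∘ x
  copair-κ₂∘ x = trans (sym assoc) (cong (_∘ x) inject₂)

  copair-diag-pred : ∀ {X C} (h : Hom X C) {r : Hom X (X + X)} → IsPred 𝒞 r →
                     [ h , h ] ∘ r ≡ h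
  copair-diag-pred h {r} pr = begin
    [ h , h ] ∘ r              ≡⟨ cong (λ k → [ k , k ] ∘ r) (sym identityʳ) ⟩
    [ h ∘ id , h ∘ id ] ∘ r    ≡⟨ cong (_∘ r) (sym (∘-copair h)) ⟩
    (h ∘ ∇ 𝒞) ∘ r              ≡⟨ assoc ⟩
    h ∘ (∇ 𝒞 ∘ r)              ≡⟨ cong (h ∘_) pr ⟩
    h ∘ id                     ≡⟨ identityʳ ⟩
    h                          ∎

  -- Kleisli extension for the monad (−) + E; note p · q = ext p ∘ q
  ext : ∀ {A B E} → Hom A (B + E) → Hom (A + E) (B + E)
  ext p = [ p , κ₂ ]

  ext-κ₁ : ∀ {A E} → ext (κ₁ {A} {E}) ≡ id
  ext-κ₁ = copair-η

  ext-compose : ∀ {A B C E} (p : Hom B (C + E)) (q : Hom A (B + E)) →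
                ext p ∘ ext q ≡ ext (ext p ∘ q)
  ext-compose p q = trans (∘-copair (ext p)) (cong₂ [_,_] refl inject₂)

  kleisli-assoc : ∀ {A B C D E} (p : Hom C (D + E)) (q : Hom B (C + E))
                  (r : Hom A (B + E)) →
                  ext p ∘ (ext q ∘ r) ≡ ext (ext p ∘ q) ∘ r
  kleisli-assoc p q r = trans (sym assoc) (cong (_∘ r) (ext-compose p q))

  ext-⊕ : ∀ {A B C E} (p : Hom B (C + E)) (f : Hom A B) →
          ext p ∘ (f ⊕ id) ≡ ext (p ∘ f)
  ext-⊕ p f = trans (∘-copair (ext p))
                    (cong₂ [_,_] (copair-κ₁∘ f) (trans (copair-κ₂∘ id) identityʳ))

  ext-natural : ∀ {A A' C C' E E'} {s : Hom A (C + E)} {q : Hom A' (C' + E')}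
                (k : Hom A A') (g : Hom C C') (h : Hom E E') →
                (g ⊕ h) ∘ s ≡ q ∘ k → (g ⊕ h) ∘ ext s ≡ ext q ∘ (k ⊕ h)
  ext-natural {s = s} {q} k g h square = begin
    (g ⊕ h) ∘ [ s , κ₂ ]                    ≡⟨ ∘-copair (g ⊕ h) ⟩
    [ (g ⊕ h) ∘ s , (g ⊕ h) ∘ κ₂ ]          ≡⟨ cong₂ [_,_] square inject₂ ⟩
    [ q ∘ k , κ₂ ∘ h ]                      ≡⟨ cong₂ [_,_] (sym (copair-κ₁∘ k)) (sym (copair-κ₂∘ h)) ⟩
    [ ext q ∘ (κ₁ ∘ k) , ext q ∘ (κ₂ ∘ h) ] ≡⟨ sym (∘-copair (ext q)) ⟩
    ext q ∘ (k ⊕ h)                         ∎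

  -- the two formulas for the product agree, since [ id , κ₂ ] ∘ (p + id) = ext p
  mul'≡mul : ∀ {X} (p q : Hom X (X + X)) → mul' 𝒞 p q ≡ p · q
  mul'≡mul p q = trans (sym assoc) (cong (_∘ q) (trans (ext-⊕ id p) (cong ext identityˡ)))

  ∇-ext : ∀ {X} {p : Hom X (X + X)} → IsPred 𝒞 p → ∇ 𝒞 ∘ ext p ≡ ∇ 𝒞
  ∇-ext pp = trans (∘-copair (∇ 𝒞)) (cong₂ [_,_] pp inject₂)

  mul-pred : ∀ {X} {p q : Hom X (X + X)} → IsPred 𝒞 p → IsPred 𝒞 q → IsPred 𝒞 (p · q)
  mul-pred pp pq = trans (sym assoc) (trans (cong (_∘ _) (∇-ext pp)) pq)

  -- associativity is Kleisli associativity; 1 = κ₁ is the Kleisli unit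
  monoid : ∀ X → MonoidOnPred 𝒞 X
  monoid _ = mul-pred
           , (λ {p} {q} {r} _ _ _ → sym (kleisli-assoc p q r))
           , (λ {p} _ → trans (cong (_∘ p) ext-κ₁) identityˡ)
           , (λ _ → inject₁)

  first-readout : ∀ {X} → ext (id {X + X}) ≡ ext [ κ₁ {X} {X} , κ₂ ]
  first-readout = cong ext (sym copair-η)

  sum-readout : ∀ {X} → ∇ 𝒞 ⊕ id ≡ ext [ κ₁ {X} {X} , κ₁ ]
  sum-readout = cong₂ [_,_] (trans (∘-copair κ₁) (cong₂ [_,_] identityʳ identityʳ)) identityʳ

  sum-transport : ∀ {X} (F : Hom X (X + X) → Hom X (X + X))
                  (B : Hom X ((X + X) + X) → Hom X ((X + X) + X)) →
                  (∀ b → ext id ∘ B b ≡ F (ext id ∘ b)) →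
                  (∀ b → ext [ κ₂ , κ₁ ] ∘ B b ≡ F (ext [ κ₂ , κ₁ ] ∘ b)) →
                  (∀ b → (∇ 𝒞 ⊕ id) ∘ B b ≡ F ((∇ 𝒞 ⊕ id) ∘ b)) →
                  ∀ {p q s} → Sum 𝒞 p q s → Sum 𝒞 (F p) (F q) (F s)
  sum-transport F B first second total (b , (bp , bq) , bs) =
    B b , (trans (first b) (cong F bp) , trans (second b) (cong F bq)) ,
    trans (total b) (cong F bs)

  sum-mulʳ : ∀ {X} (r : Hom X (X + X)) {p q s : Hom X (X + X)} →
             Sum 𝒞 p q s → Sum 𝒞 (p · r) (q · r) (s · r)
  sum-mulʳ r = sum-transport (_· r) (λ b → ext b ∘ r)
    (λ b → kleisli-assoc id b r)
    (λ b → kleisli-assoc [ κ₂ , κ₁ ] b r)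
    (λ b → trans (cong (_∘ (ext b ∘ r)) sum-readout)
           (trans (kleisli-assoc [ κ₁ , κ₁ ] b r)
                  (cong (λ ρ → ext (ρ ∘ b) ∘ r) (sym sum-readout))))

  Central : ∀ {X} → Hom X (X + X) → Hom X (X + X) → Set ℓ
  Central r g = g · r ≡ r · g

  central-κ₁ : ∀ {X} (r : Hom X (X + X)) → Central r κ₁
  central-κ₁ r = trans (cong (_∘ r) ext-κ₁) (trans identityˡ (sym inject₁))

  central-κ₂ : ∀ {X} {r : Hom X (X + X)} → IsPred 𝒞 r → Central r κ₂
  central-κ₂ pr = trans (copair-diag-pred κ₂ pr) (sym inject₂)

  -- scale r sends a bound for (p, q) to a bound for (r · p, r · q):
  -- it multiplies each summand of (X + X) + X by r.
  scale : ∀ {X} → Hom X (X + X) → Hom ((X + X) + X) ((X + X) + X)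
  scale r = ext [ (κ₁ ⊕ id) ∘ r , (κ₂ ⊕ id) ∘ r ]

  readout-summand : ∀ {X} (r : Hom X (X + X)) (G : Hom (X + X) (X + X))
                    (k : Hom X (X + X)) {g : Hom X (X + X)} →
                    G ∘ k ≡ g → Central r g → ext G ∘ ((k ⊕ id) ∘ r) ≡ ext r ∘ g
  readout-summand r G k {g} Gk central = begin
    ext G ∘ ((k ⊕ id) ∘ r)   ≡⟨ sym assoc ⟩
    (ext G ∘ (k ⊕ id)) ∘ r   ≡⟨ cong (_∘ r) (ext-⊕ G k) ⟩
    ext (G ∘ k) ∘ r          ≡⟨ cong (λ h → ext h ∘ r) Gk ⟩
    g · r                    ≡⟨ central ⟩
    ext r ∘ g                ∎

  readout-scale : ∀ {X} (r : Hom X (X + X)) {g₁ g₂ : Hom X (X + X)} →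
                  Central r g₁ → Central r g₂ →
                  ext [ g₁ , g₂ ] ∘ scale r ≡ ext r ∘ ext [ g₁ , g₂ ]
  readout-scale r {g₁} {g₂} c₁ c₂ = begin
    ext G ∘ scale r
      ≡⟨ ext-compose G _ ⟩
    ext (ext G ∘ [ (κ₁ ⊕ id) ∘ r , (κ₂ ⊕ id) ∘ r ])
      ≡⟨ cong ext (∘-copair (ext G)) ⟩
    ext [ ext G ∘ ((κ₁ ⊕ id) ∘ r) , ext G ∘ ((κ₂ ⊕ id) ∘ r) ]
      ≡⟨ cong ext (cong₂ [_,_] (readout-summand r G κ₁ inject₁ c₁)
                               (readout-summand r G κ₂ inject₂ c₂)) ⟩
    ext [ ext r ∘ g₁ , ext r ∘ g₂ ]
      ≡⟨ cong ext (sym (∘-copair (ext r))) ⟩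
    ext (ext r ∘ G)
      ≡⟨ sym (ext-compose r G) ⟩
    ext r ∘ ext G ∎
    where
    G = [ g₁ , g₂ ]

  sum-mulˡ : ∀ {X} {r : Hom X (X + X)} → IsPred 𝒞 r → {p q s : Hom X (X + X)} →
             Sum 𝒞 p q s → Sum 𝒞 (r · p) (r · q) (r · s)
  sum-mulˡ {r = r} pr = sum-transport (r ·_) (λ b → scale r ∘ b)
    (via first-readout (central-κ₁ r) (central-κ₂ pr))
    (via refl (central-κ₂ pr) (central-κ₁ r))
    (via sum-readout (central-κ₁ r) (central-κ₁ r))
    where
    via : ∀ {ρ g₁ g₂} → ρ ≡ ext [ g₁ , g₂ ] → Central r g₁ → Central r g₂ →
          ∀ b → ρ ∘ (scale r ∘ b) ≡ r · (ρ ∘ b)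
    via {ρ} eq c₁ c₂ b rewrite eq =
      trans (sym assoc) (trans (cong (_∘ b) (readout-scale r c₁ c₂)) assoc)

  -- zero laws: r · 0 = 0 by computation, 0 · r = [ κ₂ , κ₂ ] ∘ r = 0
  bihom : ∀ X → IsEffectAlgebra 𝒞 X → MulBihomomorphism 𝒞 X
  bihom _ _ = (λ pr _ _ → sum-mulˡ pr)
            , (λ _ → inject₂)
            , (λ {r} _ _ _ → sum-mulʳ r)
            , (λ pr → copair-diag-pred κ₂ pr)

  module _ {X Y : Obj} {f : Hom X Y} (pb : DIsPullback 𝒞 f) where
    open DIsPullback pb

    subst*-unique : ∀ (q : Hom Y (Y + Y)) (pq : IsPred 𝒞 q) (w : Hom X (X + X)) →
                    (f ⊕ f) ∘ w ≡ q ∘ f → IsPred 𝒞 w → subst* 𝒞 pb q pq ≡ w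
    subst*-unique q pq w top left = sym (mediate-unique (substSquare 𝒞 f q pq) w top left)

    subst*-top : ∀ (q : Hom Y (Y + Y)) (pq : IsPred 𝒞 q) →
                 (f ⊕ f) ∘ subst* 𝒞 pb q pq ≡ q ∘ f
    subst*-top q pq = mediate-top (substSquare 𝒞 f q pq)

    subst*-pred : ∀ (q : Hom Y (Y + Y)) (pq : IsPred 𝒞 q) → IsPred 𝒞 (subst* 𝒞 pb q pq)
    subst*-pred q pq = mediate-left (substSquare 𝒞 f q pq)

    subst*-mul : ∀ (q₁ q₂ : Hom Y (Y + Y)) (pq₁ : IsPred 𝒞 q₁) (pq₂ : IsPred 𝒞 q₂)
                 (pq₁₂ : IsPred 𝒞 (q₁ · q₂)) →
                 subst* 𝒞 pb (q₁ · q₂) pq₁₂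
                   ≡ subst* 𝒞 pb q₁ pq₁ · subst* 𝒞 pb q₂ pq₂
    subst*-mul q₁ q₂ pq₁ pq₂ pq₁₂ =
      subst*-unique (q₁ · q₂) pq₁₂ (s₁ · s₂) top
        (mul-pred (subst*-pred q₁ pq₁) (subst*-pred q₂ pq₂))
      where
      s₁ = subst* 𝒞 pb q₁ pq₁
      s₂ = subst* 𝒞 pb q₂ pq₂
      top : (f ⊕ f) ∘ (ext s₁ ∘ s₂) ≡ (ext q₁ ∘ q₂) ∘ f
      top = begin
        (f ⊕ f) ∘ (ext s₁ ∘ s₂)   ≡⟨ sym assoc ⟩
        ((f ⊕ f) ∘ ext s₁) ∘ s₂   ≡⟨ cong (_∘ s₂) (ext-natural f f f (subst*-top q₁ pq₁)) ⟩
        (ext q₁ ∘ (f ⊕ f)) ∘ s₂   ≡⟨ assoc ⟩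
        ext q₁ ∘ ((f ⊕ f) ∘ s₂)   ≡⟨ cong (ext q₁ ∘_) (subst*-top q₂ pq₂) ⟩
        ext q₁ ∘ (q₂ ∘ f)         ≡⟨ sym assoc ⟩
        (ext q₁ ∘ q₂) ∘ f         ∎

lemma7p1 : ∀ {o ℓ : Level} (𝒞 : CategoryWithCoproducts o ℓ) →
    let open CategoryWithCoproducts 𝒞 in
    (∀ {X : Obj} (p q : Hom X (X + X)) → mul' 𝒞 p q ≡ mul 𝒞 p q) ×
    (∀ (X : Obj) → MonoidOnPred 𝒞 X) ×
    (∀ (X : Obj) → IsEffectAlgebra 𝒞 X → MulBihomomorphism 𝒞 X) ×
    (∀ {X Y : Obj} (f : Hom X Y) (pb : DIsPullback 𝒞 f)
       (q₁ q₂ : Hom Y (Y + Y)) (pq₁ : IsPred 𝒞 q₁) (pq₂ : IsPred 𝒞 q₂)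
       (pq₁₂ : IsPred 𝒞 (mul 𝒞 q₁ q₂)) →
       subst* 𝒞 pb (mul 𝒞 q₁ q₂) pq₁₂
         ≡ mul 𝒞 (subst* 𝒞 pb q₁ pq₁) (subst* 𝒞 pb q₂ pq₂))
lemma7p1 𝒞 = mul'≡mul , monoid , bihom , λ f pb → subst*-mul pb
  where open Lemmas 𝒞
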